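{- Let $x$ be a feasible solution of the distance LP for a Directed Multicut instance $(G,H)$ with $V_H=\{s_1,\dots,s_k\}$, let $d(u,v)$ be the shortest-path distance from $u$ to $v$ in $G$ with edge lengths $x_e$, and assume $d(u,v)\le 1$ for all $u,v\in V_G$. For each $u\in V_G$ fix a permutation $\pi^u$ of $\{1,\dots,k\}$ with $d(s_{\pi^u(1)},u)\le\dots\le d(s_{\pi^u(k)},u)$, let $\sigma^u_i\in L=\{0,1\}^k$ ($0\le i\le k$) be the vector with $\sigma^u_i[j]=1$ iff $j\in\{\pi^u(1),\dots,\pi^u(i)\}$, and define $z_{u,\sigma^u_0}=d(s_{\pi^u(1)},u)$, $z_{u,\sigma^u_i}=d(s_{\pi^u(i+1)},u)-d(s_{\pi^u(i)},u)$ for $1\le i\le k-1$, $z_{u,\sigma^u_k}=1-d(s_{\pi^u(k)},u)$, and $z_{u,\sigma}=0$ for $\sigma\notin\{\sigma^u_0,\dots,\sigma^u_k\}$. Then: (a) $z_{u,\sigma}\ge 0$ for all $u,\sigma$; (b) $\sum_{\sigma\in L} z_{u,\sigma}=1$ for all $u$; (c) for every nonempty $A\subseteq\{1,\dots,k\}$, letting $\sigma_A\in L$ be the indicator vector of $A$, $\sum_{\sigma\ge\sigma_A} z_{u,\sigma}=1-\max_{i\in A} d(s_i,u)$; (d) for every $j$ and every $\sigma\in L$ with $\sigma[j]=0$, $z_{s_j,\sigma}=0$; (e) if $(s_i,s_j)\in E_H$ then $z_{s_j,\sigma}=0$ for every $\sigma\in L$ with $\sigma[i]=1$.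
   Context: Directed Multicut instance: directed supply graph $G=(V_G,E)$ with nonnegative edge weights $w_e$, directed demand graph $H$ with vertex set $V_H=\{s_1,\dots,s_k\}\subseteq V_G$ and edge set $E_H$. Distance LP: minimize $\sum_e w_e x_e$ subject to $\sum_{e\in p}x_e\ge1$ for every directed path $p$ from $s_i$ to $s_j$ in $G$ with $(s_i,s_j)\in E_H$, and $x_e\ge0$. For $\sigma,\sigma'\in\{0,1\}^k$, $\sigma\ge\sigma'$ means $\sigma[i]\ge\sigma'[i]$ for all $i$.
   Formalization: The edge weights $w_e$, the edge lengths $x_e$ of the feasible LP solution and the distances $d(u,v)$ take values in the rationals. -}

module Defs where

open import Data.Nat using (ℕ; zero; suc; _<ᵇ_; _<?_)
open import Data.Fin using (Fin; zero; suc; toℕ; fromℕ<; _≤_)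
open import Data.Fin.Permutation using (Permutation′; _⟨$⟩ʳ_; _⟨$⟩ˡ_)
open import Data.Fin.Subset using (Subset; _∈_; _⊆_; inside; outside)
open import Data.Fin.Subset.Properties using (_⊆?_)
open import Data.Bool using (Bool)
import Data.Bool.Properties as BoolP
open import Data.Vec using (Vec; []; _∷_; tabulate)
open import Data.Vec.Properties using (≡-dec)
open import Data.List using (List; []; _∷_; map; _++_; foldr; filter; allFin)
open import Data.Rational using (ℚ; 0ℚ; 1ℚ; _+_; _-_)
import Data.Rational as Q
open import Data.Product using (Σ; ∃; _×_; _,_)
open import Relation.Binary.PropositionalEquality using (_≡_)
open import Relation.Nullary using (yes; no)

record Digraph : Set where
  field
    nV nE : ℕ
    src tgt : Fin nE → Fin nV
open Digraph public

data Walk (G : Digraph) : Fin (nV G) → Fin (nV G) → Set where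
  []  : ∀ {u} → Walk G u u
  _∷_ : ∀ {v} (e : Fin (nE G)) → Walk G (tgt G e) v → Walk G (src G e) v

len : (G : Digraph) (x : Fin (nE G) → ℚ) {u v : Fin (nV G)} → Walk G u v → ℚ
len G x []      = 0ℚ
len G x (e ∷ p) = x e + len G x p

-- Feasibility for the distance LP of the instance (G , H), where the demand
-- graph H has vertices s 0 … s (k-1) and edge relation EH.
Feasible : (G : Digraph) (x : Fin (nE G) → ℚ) {k : ℕ}
           (s : Fin k → Fin (nV G)) (EH : Fin k → Fin k → Set) → Set
Feasible G x s EH =
  (∀ e → 0ℚ Q.≤ x e) ×
  (∀ i j → EH i j → (p : Walk G (s i) (s j)) → 1ℚ Q.≤ len G x p)

IsShortestDist : (G : Digraph) (x : Fin (nE G) → ℚ)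
                 (d : Fin (nV G) → Fin (nV G) → ℚ) → Set
IsShortestDist G x d = ∀ u v →
  (Σ (Walk G u v) λ p → len G x p ≡ d u v) × ((p : Walk G u v) → d u v Q.≤ len G x p)

-- π u sorts the terminals by distance to u:
-- d(s_{π^u(1)},u) ≤ … ≤ d(s_{π^u(k)},u)   (indices 0-based here).
Sorted : {n k : ℕ} (s : Fin k → Fin n) (d : Fin n → Fin n → ℚ)
         (π : Fin n → Permutation′ k) → Set
Sorted s d π = ∀ u (a b : Fin _) → a ≤ b →
  d (s (π u ⟨$⟩ʳ a)) u Q.≤ d (s (π u ⟨$⟩ʳ b)) u

-- L = {0,1}^k, as the list of all subsets (Bool vectors) of Fin k.
allL : (k : ℕ) → List (Subset k)
allL zero    = [] ∷ []
allL (suc k) = map (outside ∷_) (allL k) ++ map (inside ∷_) (allL k)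

sumℚ : List ℚ → ℚ
sumℚ = foldr _+_ 0ℚ

sumL : (k : ℕ) → (Subset k → ℚ) → ℚ
sumL k f = sumℚ (map f (allL k))

-- σ ≥ σ' (componentwise) is  σ' ⊆ σ ;  Σ_{σ ≥ σ'} f σ
sumGe : (k : ℕ) → Subset k → (Subset k → ℚ) → ℚ
sumGe k σ' f = sumℚ (map f (filter (σ' ⊆?_) (allL k)))

module Construction {n κ : ℕ} (s : Fin (suc κ) → Fin n)
                    (d : Fin n → Fin n → ℚ) (π : Fin n → Permutation′ (suc κ)) where
  -- Dπ u j = d(s_{π^u(j+1)}, u)   (0-based j)
  Dπ : Fin n → Fin (suc κ) → ℚ
  Dπ u j = d (s (π u ⟨$⟩ʳ j)) u

  sig : Fin n → Fin (suc (suc κ)) → Subset (suc κ)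
  sig u i = tabulate λ j → toℕ (π u ⟨$⟩ˡ j) <ᵇ toℕ i

  zval : Fin n → Fin (suc (suc κ)) → ℚ
  zval u zero = Dπ u zero
  zval u (suc j) with toℕ j <? κ
  ... | yes j<κ = Dπ u (suc (fromℕ< j<κ)) - Dπ u j
  ... | no  _   = 1ℚ - Dπ u j

  zsearch : Fin n → Subset (suc κ) → List (Fin (suc (suc κ))) → ℚ
  zsearch u σ [] = 0ℚ
  zsearch u σ (i ∷ is) with ≡-dec BoolP._≟_ σ (sig u i)
  ... | yes _ = zval u i
  ... | no  _ = zsearch u σ is

  z : Fin n → Subset (suc κ) → ℚ
  z u σ = zsearch u σ (allFin (suc (suc κ)))

  IsMaxDist : Subset (suc κ) → Fin n → ℚ → Set
  IsMaxDist A u m = (∃ λ i → i ∈ A × m ≡ d (s i) u) × (∀ i → i ∈ A → d (s i) u Q.≤ m)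

{-# OPTIONS --safe #-}
module Submission where

-- Pad the sorted distances of u to 0 = ℓ₀ ≤ ℓ₁ ≤ … ≤ ℓₖ ≤ ℓₖ₊₁ = 1, where
-- ℓₜ = d(s_{π^u(t)}, u). Then z_{u,σ^u_i} = ℓ_{i+1} − ℓ_i ≥ 0, and since the
-- chain σ^u_0 ⊂ … ⊂ σ^u_k has no repetitions, summing z_{u,·} over the sets
-- σ ⊇ A picks out exactly the σ^u_i with i > p, where p is the last position of
-- an element of A; this sum telescopes to 1 − ℓ_{p+1} = 1 − max_{i∈A} d(s_i,u),
-- and to 1 for A = ∅. If d(s_j,u) = 0 the sequence ℓ is 0 up to the position of
-- s_j, and if d(s_i,u) = 1 it is 1 from the position of s_i on, so the
-- corresponding increments vanish.

open import Defs
open import Data.Nat as ℕ using (ℕ; zero; suc; z≤n; s≤s; _<ᵇ_)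
import Data.Nat.Properties as ℕₚ
open import Data.Fin using (Fin; zero; suc; toℕ; fromℕ<)
import Data.Fin.Properties as Finₚ
open import Data.Fin.Permutation using (Permutation′; _⟨$⟩ʳ_; _⟨$⟩ˡ_; inverseˡ; inverseʳ)
open import Data.Fin.Subset using (Subset; _∈_; _∉_; _⊆_; Nonempty; inside; outside)
open import Data.Fin.Subset.Properties using (_⊆?_; _∈?_)
open import Data.Bool using (Bool; true; false)
import Data.Bool.Properties as Boolₚ
open import Data.Vec using ([]; _∷_)
open import Data.Vec.Properties using (≡-dec; ∷-injectiveˡ; ∷-injectiveʳ; lookup∘tabulate; []=⇒lookup; lookup⇒[]=)
open import Data.List using (List; []; _∷_; map; _++_; filter; allFin; tabulate)
open import Data.List.Properties using (map-cong; map-++; map-∘; map-tabulate)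
import Data.List.Relation.Unary.All as All
open import Data.List.Relation.Unary.All using (All; []; _∷_)
open import Data.List.Relation.Unary.All.Properties using (tabulate⁺)
open import Data.List.Relation.Unary.AllPairs using ([]; _∷_)
open import Data.List.Relation.Unary.Unique.Propositional using (Unique)
open import Data.List.Relation.Unary.Unique.Propositional.Properties using (allFin⁺)
open import Data.Rational using (ℚ; 0ℚ; 1ℚ; _≤_; _+_; _-_; -_)
open import Data.Rational.Properties using (≤-refl; ≤-antisym; +-mono-≤; +-monoˡ-≤; +-identityˡ; +-identityʳ; +-inverseʳ; +-assoc; nonNegative⁻¹)
open import Data.Rational.Solver using (module +-*-Solver)
open import Data.Product using (_×_; _,_; ∃; proj₂)
open import Data.Unit using (tt)
open import Function using (_∘_; _⇔_; mk⇔; Equivalence)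
open import Function.Definitions using (Injective)
open import Level using (Level)
open import Relation.Binary.PropositionalEquality
open import Relation.Nullary using (Dec; yes; no; ¬_; contradiction)
open import Relation.Unary using (Pred; Decidable)

open Equivalence using (to; from)

private
  variable
    a ℓ ℓ′ : Level
    A : Set a
    P : Set ℓ
    Q : Set ℓ′

p≤q⇒0≤q-p : ∀ {p q} → p ≤ q → 0ℚ ≤ q - p
p≤q⇒0≤q-p {p} {q} p≤q = subst (_≤ q - p) (+-inverseʳ p) (+-monoˡ-≤ (- p) p≤q)

infixr 7 [_]·_

[_]·_ : Dec P → ℚ → ℚ
[ yes _ ]· c = c
[ no  _ ]· c = 0ℚ

[]·-no : ¬ P → (D : Dec P) (c : ℚ) → [ D ]· c ≡ 0ℚ
[]·-no ¬pf (yes pf) c = contradiction pf ¬pf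
[]·-no _   (no _)   c = refl

[]·-zero : (D : Dec P) → [ D ]· 0ℚ ≡ 0ℚ
[]·-zero (yes _) = refl
[]·-zero (no  _) = refl

[]·-cong : P ⇔ Q → (D : Dec P) (E : Dec Q) (c : ℚ) → [ D ]· c ≡ [ E ]· c
[]·-cong P⇔Q (yes _)  (yes _)  c = refl
[]·-cong P⇔Q (yes pf) (no ¬qf) c = contradiction (to P⇔Q pf) ¬qf
[]·-cong P⇔Q (no ¬pf) (yes qf) c = contradiction (from P⇔Q qf) ¬pf
[]·-cong P⇔Q (no _)   (no _)   c = refl

[]·-comm : (D : Dec P) (E : Dec Q) (c : ℚ) → [ D ]· [ E ]· c ≡ [ E ]· [ D ]· c
[]·-comm (yes _) E c = refl
[]·-comm (no  _) E c = sym ([]·-zero E)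

[]·-distrib-+ : (D : Dec P) (b c : ℚ) → [ D ]· (b + c) ≡ [ D ]· b + [ D ]· c
[]·-distrib-+ (yes _) b c = refl
[]·-distrib-+ (no  _) b c = refl

sumℚ-++ : ∀ xs ys → sumℚ (xs ++ ys) ≡ sumℚ xs + sumℚ ys
sumℚ-++ []       ys = sym (+-identityˡ _)
sumℚ-++ (x ∷ xs) ys = trans (cong (x +_) (sumℚ-++ xs ys)) (sym (+-assoc x _ _))

sumℚ-zero : {f : A → ℚ} → (∀ x → f x ≡ 0ℚ) → ∀ xs → sumℚ (map f xs) ≡ 0ℚ
sumℚ-zero f≡0 []       = refl
sumℚ-zero f≡0 (x ∷ xs) = cong₂ _+_ (f≡0 x) (sumℚ-zero f≡0 xs)

sumℚ-+ : (f g : A → ℚ) → ∀ xs →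
         sumℚ (map (λ x → f x + g x) xs) ≡ sumℚ (map f xs) + sumℚ (map g xs)
sumℚ-+ f g []       = refl
sumℚ-+ f g (x ∷ xs) = trans (cong (f x + g x +_) (sumℚ-+ f g xs))
  (interchange (f x) (g x) (sumℚ (map f xs)) (sumℚ (map g xs)))
  where
  open +-*-Solver
  interchange : ∀ a b c d → (a + b) + (c + d) ≡ (a + c) + (b + d)
  interchange = solve 4 (λ a b c d → (a :+ b) :+ (c :+ d) := (a :+ c) :+ (b :+ d)) refl

sumℚ-filter : {P : Pred A ℓ} (P? : Decidable P) (f : A → ℚ) → ∀ xs →
              sumℚ (map f (filter P? xs)) ≡ sumℚ (map (λ x → [ P? x ]· f x) xs)
sumℚ-filter P? f [] = refl
sumℚ-filter P? f (x ∷ xs) with P? x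
... | yes _ = cong (f x +_) (sumℚ-filter P? f xs)
... | no  _ = trans (sumℚ-filter P? f xs) (sym (+-identityˡ _))

∑< : ℕ → (ℕ → ℚ) → ℚ
∑< zero    f = 0ℚ
∑< (suc n) f = ∑< n f + f n

infix 5 ∑<
syntax ∑< n (λ t → e) = ∑[ t < n ] e

∑<-zero : ∀ {n} {f : ℕ → ℚ} → (∀ t → t ℕ.< n → f t ≡ 0ℚ) → ∑< n f ≡ 0ℚ
∑<-zero {zero}  f≡0 = refl
∑<-zero {suc n} f≡0 =
  cong₂ _+_ (∑<-zero (λ t t<n → f≡0 t (ℕₚ.m<n⇒m<1+n t<n))) (f≡0 n (ℕₚ.n<1+n n))

∑<-front : ∀ n (f : ℕ → ℚ) → ∑< (suc n) f ≡ f 0 + ∑< n (f ∘ suc)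
∑<-front zero    f = trans (+-identityˡ (f 0)) (sym (+-identityʳ (f 0)))
∑<-front (suc n) f = trans (cong (_+ f (suc n)) (∑<-front n f)) (+-assoc (f 0) _ _)

sumℚ-allFin : ∀ n (f : ℕ → ℚ) → sumℚ (map (f ∘ toℕ) (allFin n)) ≡ ∑< n f
sumℚ-allFin zero    f = refl
sumℚ-allFin (suc n) f = begin
  f 0 + sumℚ (map (f ∘ toℕ) (tabulate (λ (i : Fin n) → suc i)))
    ≡⟨ cong (λ xs → f 0 + sumℚ xs) (trans (map-tabulate {n = n} suc (f ∘ toℕ))
                                          (sym (map-tabulate (λ i → i) (f ∘ suc ∘ toℕ)))) ⟩
  f 0 + sumℚ (map (f ∘ suc ∘ toℕ) (allFin n))
    ≡⟨ cong (f 0 +_) (sumℚ-allFin n (f ∘ suc)) ⟩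
  f 0 + ∑< n (f ∘ suc)
    ≡⟨ sym (∑<-front n f) ⟩
  ∑< (suc n) f ∎
  where open ≡-Reasoning

∑<-telescope : ∀ (f : ℕ → ℚ) {q} n → q ℕ.≤ n →
               ∑[ t < n ] [ q ℕ.≤? t ]· (f (suc t) - f t) ≡ f n - f q
∑<-telescope f zero z≤n = sym (+-inverseʳ (f 0))
∑<-telescope f {q} (suc n) q≤1+n with q ℕ.≤? n
... | yes q≤n = begin
  (∑[ t < n ] [ q ℕ.≤? t ]· (f (suc t) - f t)) + (f (suc n) - f n)
    ≡⟨ cong (_+ (f (suc n) - f n)) (∑<-telescope f n q≤n) ⟩
  (f n - f q) + (f (suc n) - f n)
    ≡⟨ cancel (f n) (f q) (f (suc n)) ⟩
  f (suc n) - f q ∎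
  where
  open ≡-Reasoning
  open +-*-Solver
  cancel : ∀ a b c → (a - b) + (c - a) ≡ c - b
  cancel = solve 3 (λ a b c → (a :- b) :+ (c :- a) := c :- b) refl
... | no  q≰n = begin
  (∑[ t < n ] [ q ℕ.≤? t ]· (f (suc t) - f t)) + 0ℚ
    ≡⟨ +-identityʳ _ ⟩
  ∑[ t < n ] [ q ℕ.≤? t ]· (f (suc t) - f t)
    ≡⟨ ∑<-zero (λ t t<n → []·-no (λ q≤t → q≰n (ℕₚ.≤-trans q≤t (ℕₚ.<⇒≤ t<n))) (q ℕ.≤? t) _) ⟩
  0ℚ
    ≡⟨ sym (+-inverseʳ (f (suc n))) ⟩
  f (suc n) - f (suc n)
    ≡⟨ cong (λ r → f (suc n) - f r) (ℕₚ.≤-antisym (ℕₚ.≰⇒> q≰n) q≤1+n) ⟩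
  f (suc n) - f q ∎
  where open ≡-Reasoning

∀<⇒≤ : ∀ {m} {i j : Fin (suc m)} →
       (∀ (a : Fin m) → toℕ a ℕ.< toℕ i → toℕ a ℕ.< toℕ j) → toℕ i ℕ.≤ toℕ j
∀<⇒≤ {i = zero}  _       = z≤n
∀<⇒≤ {i = suc i} a<i⇒a<j = a<i⇒a<j i (ℕₚ.n<1+n (toℕ i))

∃-greatest : ∀ {m} {P : Pred (Fin m) ℓ} → Decidable P → ∃ P →
             ∃ λ i → P i × (∀ j → P j → toℕ j ℕ.≤ toℕ i)
∃-greatest {m = suc m} P? (i , Pi) with Finₚ.any? (P? ∘ suc)
... | yes ∃Psuc with ∃-greatest (P? ∘ suc) ∃Psuc
...   | j , Pj , greatest = suc j , Pj , λ where
  zero    _  → z≤n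
  (suc k) Pk → s≤s (greatest k Pk)
∃-greatest P? (zero  , P0) | no ¬∃Psuc = zero , P0 , λ where
  zero    _  → z≤n
  (suc k) Pk → contradiction (k , Pk) ¬∃Psuc
∃-greatest P? (suc i , Pi) | no ¬∃Psuc = contradiction (i , Pi) ¬∃Psuc

module _ (G : Digraph) {x : Fin (nE G) → ℚ} (x≥0 : ∀ e → 0ℚ ≤ x e) where

  len-nonneg : ∀ {u v} (p : Walk G u v) → 0ℚ ≤ len G x p
  len-nonneg []      = ≤-refl
  len-nonneg (e ∷ p) = +-mono-≤ (x≥0 e) (len-nonneg p)

  module _ {d : Fin (nV G) → Fin (nV G) → ℚ} (shortest : IsShortestDist G x d) where

    dist-nonneg : ∀ u v → 0ℚ ≤ d u v
    dist-nonneg u v with shortest u v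
    ... | (p , len≡d) , _ = subst (0ℚ ≤_) len≡d (len-nonneg p)

    dist-self : ∀ v → d v v ≡ 0ℚ
    dist-self v = ≤-antisym (proj₂ (shortest v v) []) (dist-nonneg v v)

demand-dist-≥1 : ∀ {G x k} {s : Fin k → Fin (nV G)} {EH d} → Feasible G x s EH →
                 IsShortestDist G x d → ∀ {i j} → EH i j → 1ℚ ≤ d (s i) (s j)
demand-dist-≥1 {s = s} (_ , cut) shortest {i} {j} e with shortest (s i) (s j)
... | (p , len≡d) , _ = subst (1ℚ ≤_) len≡d (cut i j e p)

infix 4 _≟ˢ_

_≟ˢ_ : ∀ {k} (σ τ : Subset k) → Dec (σ ≡ τ)
_≟ˢ_ = ≡-dec Boolₚ._≟_

sumL-cong : ∀ {k} {f g : Subset k → ℚ} → (∀ σ → f σ ≡ g σ) → sumL k f ≡ sumL k g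
sumL-cong {k} f≡g = cong sumℚ (map-cong f≡g (allL k))

sumL-suc : ∀ k (f : Subset (suc k) → ℚ) →
           sumL (suc k) f ≡ sumL k (f ∘ (outside ∷_)) + sumL k (f ∘ (inside ∷_))
sumL-suc k f = begin
  sumℚ (map f (outs ++ ins))                 ≡⟨ cong sumℚ (map-++ f outs ins) ⟩
  sumℚ (map f outs ++ map f ins)             ≡⟨ sumℚ-++ (map f outs) (map f ins) ⟩
  sumℚ (map f outs) + sumℚ (map f ins)       ≡⟨ sym (cong₂ _+_ (cong sumℚ (map-∘ (allL k))) (cong sumℚ (map-∘ (allL k)))) ⟩
  sumL k (f ∘ (outside ∷_)) + sumL k (f ∘ (inside ∷_)) ∎
  where
  open ≡-Reasoning
  outs ins : List (Subset (suc k))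
  outs = map (outside ∷_) (allL k)
  ins  = map (inside ∷_) (allL k)

sumL-δ : ∀ k (f : Subset k → ℚ) τ → sumL k (λ σ → [ σ ≟ˢ τ ]· f σ) ≡ f τ
sumL-δ zero    f [] = +-identityʳ (f [])
sumL-δ (suc k) f (b ∷ τ) = trans (sumL-suc k _) (split b)
  where
  same : ∀ c → sumL k (λ σ → [ c ∷ σ ≟ˢ c ∷ τ ]· f (c ∷ σ)) ≡ f (c ∷ τ)
  same c = trans
    (sumL-cong (λ σ → []·-cong (mk⇔ ∷-injectiveʳ (cong (c ∷_))) (c ∷ σ ≟ˢ c ∷ τ) (σ ≟ˢ τ) (f (c ∷ σ))))
    (sumL-δ k (f ∘ (c ∷_)) τ)
  different : ∀ c b → c ≢ b → sumL k (λ σ → [ c ∷ σ ≟ˢ b ∷ τ ]· f (c ∷ σ)) ≡ 0ℚ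
  different c b c≢b = sumℚ-zero (λ σ → []·-no (c≢b ∘ ∷-injectiveˡ) (c ∷ σ ≟ˢ b ∷ τ) _) (allL k)
  split : ∀ b → sumL k (λ σ → [ outside ∷ σ ≟ˢ b ∷ τ ]· f (outside ∷ σ))
                + sumL k (λ σ → [ inside ∷ σ ≟ˢ b ∷ τ ]· f (inside ∷ σ)) ≡ f (b ∷ τ)
  split false = trans (cong₂ _+_ (same false) (different true false λ ())) (+-identityʳ _)
  split true  = trans (cong₂ _+_ (different false true λ ()) (same true)) (+-identityˡ _)

module Levels {n κ : ℕ} (s : Fin (suc κ) → Fin n) (d : Fin n → Fin n → ℚ)
              (π : Fin n → Permutation′ (suc κ)) where
  open Construction s d π

  -- level u t is ℓₜ, with 1-based positions t whereas π and Dπ are 0-based.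
  level : Fin n → ℕ → ℚ
  level u zero = 0ℚ
  level u (suc t) with t ℕ.<? suc κ
  ... | yes t<k = Dπ u (fromℕ< t<k)
  ... | no  _   = 1ℚ

  level-position : ∀ u j → level u (suc (toℕ j)) ≡ Dπ u j
  level-position u j with toℕ j ℕ.<? suc κ
  ... | yes j<k = cong (Dπ u) (Finₚ.fromℕ<-toℕ j j<k)
  ... | no  j≮k = contradiction (Finₚ.toℕ<n j) j≮k

  level-terminal : ∀ u j → level u (suc (toℕ (π u ⟨$⟩ˡ j))) ≡ d (s j) u
  level-terminal u j = trans (level-position u _) (cong (λ i → d (s i) u) (inverseʳ (π u)))

  level-beyond : ∀ u {t} → suc κ ℕ.≤ t → level u (suc t) ≡ 1ℚ
  level-beyond u {t} k≤t with t ℕ.<? suc κ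
  ... | yes t<k = contradiction t<k (ℕₚ.≤⇒≯ k≤t)
  ... | no  _   = refl

  zval≡Δlevel : ∀ u i → zval u i ≡ level u (suc (toℕ i)) - level u (toℕ i)
  zval≡Δlevel u zero = sym (trans (cong (_- 0ℚ) (level-position u zero)) (+-identityʳ _))
  zval≡Δlevel u (suc j) with toℕ j ℕ.<? κ
  ... | yes j<κ = cong₂ _-_ (sym (subst (λ t → level u (suc (suc t)) ≡ Dπ u (suc (fromℕ< j<κ)))
                                         (Finₚ.toℕ-fromℕ< j<κ) (level-position u (suc (fromℕ< j<κ)))))
                            (sym (level-position u j))
  ... | no  j≮κ = cong₂ _-_ (sym (level-beyond u (s≤s (ℕₚ.≮⇒≥ j≮κ)))) (sym (level-position u j))

  ∈-sig : ∀ u i j → j ∈ sig u i ⇔ toℕ (π u ⟨$⟩ˡ j) ℕ.< toℕ i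
  ∈-sig u i j = mk⇔
    (λ j∈ → ℕₚ.<ᵇ⇒< _ _ (from Boolₚ.T-≡ (trans (sym (lookup∘tabulate isBelow j)) ([]=⇒lookup j∈))))
    (λ j< → lookup⇒[]= j (sig u i) (trans (lookup∘tabulate isBelow j) (to Boolₚ.T-≡ (ℕₚ.<⇒<ᵇ j<))))
    where
    isBelow : Fin (suc κ) → Bool
    isBelow j = toℕ (π u ⟨$⟩ˡ j) <ᵇ toℕ i

  ∈-sig-position : ∀ u i a → π u ⟨$⟩ʳ a ∈ sig u i ⇔ toℕ a ℕ.< toℕ i
  ∈-sig-position u i a = subst (λ b → π u ⟨$⟩ʳ a ∈ sig u i ⇔ toℕ b ℕ.< toℕ i) (inverseˡ (π u)) (∈-sig u i _)

  sig-⊆⇒≤ : ∀ u {i i'} → sig u i ⊆ sig u i' → toℕ i ℕ.≤ toℕ i'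
  sig-⊆⇒≤ u {i} {i'} i⊆i' = ∀<⇒≤ λ a → to (∈-sig-position u i' a) ∘ i⊆i' ∘ from (∈-sig-position u i a)

  sig-injective : ∀ u → Injective _≡_ _≡_ (sig u)
  sig-injective u eq = Finₚ.≤-antisym (sig-⊆⇒≤ u (λ {j} → subst (j ∈_) eq))
                                       (sig-⊆⇒≤ u (λ {j} → subst (j ∈_) (sym eq)))

  zsearch-elim : ∀ (P : ℚ → Set ℓ) u σ {is} → P 0ℚ →
                 All (λ i → σ ≡ sig u i → P (zval u i)) is → P (zsearch u σ is)
  zsearch-elim P u σ P0 [] = P0
  zsearch-elim P u σ {i ∷ is} P0 (Pi ∷ Pis) with ≡-dec Boolₚ._≟_ σ (sig u i)
  ... | yes σ≡ = Pi σ≡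
  ... | no  _  = zsearch-elim P u σ P0 Pis

  z-elim : ∀ (P : ℚ → Set ℓ) u σ → P 0ℚ → (∀ i → σ ≡ sig u i → P (zval u i)) → P (z u σ)
  z-elim P u σ P0 Pi = zsearch-elim P u σ P0 (tabulate⁺ {f = λ i → i} Pi)

  zsearch-∷ : ∀ u σ {i is} → All (i ≢_) is →
              zsearch u σ (i ∷ is) ≡ [ σ ≟ˢ sig u i ]· zval u i + zsearch u σ is
  zsearch-∷ u σ {i} {is} i∉is with ≡-dec Boolₚ._≟_ σ (sig u i)
  ... | yes refl = sym (trans (cong (zval u i +_) unreachable) (+-identityʳ _))
    where
    unreachable : zsearch u (sig u i) is ≡ 0ℚ
    unreachable = zsearch-elim (_≡ 0ℚ) u _ refl
      (All.map (λ i≢i' sig≡ → contradiction (sig-injective u sig≡) i≢i') i∉is)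
  ... | no  _ = sym (+-identityˡ _)

  sumL-[]·zsearch : ∀ u {P : Pred (Subset (suc κ)) ℓ} (P? : Decidable P) {is} → Unique is →
                    sumL (suc κ) (λ σ → [ P? σ ]· zsearch u σ is)
                    ≡ sumℚ (map (λ i → [ P? (sig u i) ]· zval u i) is)
  sumL-[]·zsearch u P? [] = sumℚ-zero (λ σ → []·-zero (P? σ)) (allL (suc κ))
  sumL-[]·zsearch u P? {i ∷ is} (i∉is ∷ unique) = begin
    sumL (suc κ) (λ σ → [ P? σ ]· zsearch u σ (i ∷ is))
      ≡⟨ sumL-cong (λ σ → trans (cong ([ P? σ ]·_) (zsearch-∷ u σ i∉is)) ([]·-distrib-+ (P? σ) _ _)) ⟩
    sumL (suc κ) (λ σ → [ P? σ ]· [ σ ≟ˢ sig u i ]· zval u i + [ P? σ ]· zsearch u σ is)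
      ≡⟨ sumℚ-+ _ _ (allL (suc κ)) ⟩
    sumL (suc κ) (λ σ → [ P? σ ]· [ σ ≟ˢ sig u i ]· zval u i) + sumL (suc κ) (λ σ → [ P? σ ]· zsearch u σ is)
      ≡⟨ cong₂ _+_ (trans (sumL-cong (λ σ → []·-comm (P? σ) (σ ≟ˢ sig u i) _))
                          (sumL-δ (suc κ) (λ σ → [ P? σ ]· zval u i) (sig u i)))
                   (sumL-[]·zsearch u P? unique) ⟩
    [ P? (sig u i) ]· zval u i + sumℚ (map (λ i → [ P? (sig u i) ]· zval u i) is) ∎
    where open ≡-Reasoning

  sumL-[]·z : ∀ u {P : Pred (Subset (suc κ)) ℓ} (P? : Decidable P) {q} → q ℕ.≤ suc (suc κ) →
              (∀ i → P (sig u i) ⇔ q ℕ.≤ toℕ i) →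
              sumL (suc κ) (λ σ → [ P? σ ]· z u σ) ≡ 1ℚ - level u q
  sumL-[]·z u P? {q} q≤ P⇔q≤ = begin
    sumL (suc κ) (λ σ → [ P? σ ]· z u σ)
      ≡⟨ sumL-[]·zsearch u P? (allFin⁺ (suc (suc κ))) ⟩
    sumℚ (map (λ i → [ P? (sig u i) ]· zval u i) (allFin (suc (suc κ))))
      ≡⟨ cong sumℚ (map-cong (λ i → trans ([]·-cong (P⇔q≤ i) (P? (sig u i)) (q ℕ.≤? toℕ i) _)
                                            (cong ([ q ℕ.≤? toℕ i ]·_) (zval≡Δlevel u i)))
                             (allFin (suc (suc κ)))) ⟩
    sumℚ (map (Δ ∘ toℕ) (allFin (suc (suc κ))))
      ≡⟨ sumℚ-allFin (suc (suc κ)) Δ ⟩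
    ∑< (suc (suc κ)) Δ
      ≡⟨ ∑<-telescope (level u) (suc (suc κ)) q≤ ⟩
    level u (suc (suc κ)) - level u q
      ≡⟨ cong (_- level u q) (level-beyond u ℕₚ.≤-refl) ⟩
    1ℚ - level u q ∎
    where
    open ≡-Reasoning
    Δ : ℕ → ℚ
    Δ t = [ q ℕ.≤? t ]· (level u (suc t) - level u t)

  sumL-z : ∀ u → sumL (suc κ) (z u) ≡ 1ℚ
  sumL-z u = sumL-[]·z u (λ _ → yes tt) z≤n (λ _ → mk⇔ (λ _ → z≤n) (λ _ → tt))

  module Monotone (sorted : Sorted s d π) (d≥0 : ∀ u v → 0ℚ ≤ d u v) (d≤1 : ∀ u v → d u v ≤ 1ℚ) where

    level-nonneg : ∀ u t → 0ℚ ≤ level u t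
    level-nonneg u zero = ≤-refl
    level-nonneg u (suc t) with t ℕ.<? suc κ
    ... | yes _ = d≥0 _ _
    ... | no  _ = nonNegative⁻¹ 1ℚ

    level-mono : ∀ u {t t'} → t ℕ.≤ t' → level u t ≤ level u t'
    level-mono u {zero}  {t'} _ = level-nonneg u t'
    level-mono u {suc t} {suc t'} (s≤s t≤t') with t ℕ.<? suc κ | t' ℕ.<? suc κ
    ... | yes t<k | yes t'<k = sorted u (fromℕ< t<k) (fromℕ< t'<k)
      (subst₂ ℕ._≤_ (sym (Finₚ.toℕ-fromℕ< t<k)) (sym (Finₚ.toℕ-fromℕ< t'<k)) t≤t')
    ... | yes _   | no  _    = d≤1 _ _
    ... | no  t≮k | yes t'<k = contradiction (ℕₚ.≤-<-trans t≤t' t'<k) t≮k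
    ... | no  _   | no  _    = ≤-refl

    level-pinned : ∀ u {a b t c} → level u a ≡ c → level u b ≡ c → a ℕ.≤ t → t ℕ.≤ b → level u t ≡ c
    level-pinned u {t = t} refl lb≡c a≤t t≤b =
      ≤-antisym (subst (level u t ≤_) lb≡c (level-mono u t≤b)) (level-mono u a≤t)

    zval-flat : ∀ u i {a b c} → level u a ≡ c → level u b ≡ c → a ℕ.≤ toℕ i → toℕ i ℕ.< b →
                zval u i ≡ 0ℚ
    zval-flat u i {c = c} la≡c lb≡c a≤i i<b = begin
      zval u i                                  ≡⟨ zval≡Δlevel u i ⟩
      level u (suc (toℕ i)) - level u (toℕ i)   ≡⟨ cong₂ _-_ (level-pinned u la≡c lb≡c (ℕₚ.m≤n⇒m≤1+n a≤i) i<b)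
                                                             (level-pinned u la≡c lb≡c a≤i (ℕₚ.<⇒≤ i<b)) ⟩
      c - c                                     ≡⟨ +-inverseʳ c ⟩
      0ℚ ∎
      where open ≡-Reasoning

    z-nonneg : ∀ u σ → 0ℚ ≤ z u σ
    z-nonneg u σ = z-elim (0ℚ ≤_) u σ ≤-refl λ i _ →
      subst (0ℚ ≤_) (sym (zval≡Δlevel u i)) (p≤q⇒0≤q-p (level-mono u (ℕₚ.n≤1+n (toℕ i))))

    near⇒z≡0 : ∀ {u j σ} → d (s j) u ≡ 0ℚ → j ∉ σ → z u σ ≡ 0ℚ
    near⇒z≡0 {u} {j} {σ} d≡0 j∉σ = z-elim (_≡ 0ℚ) u σ refl λ i σ≡ →
      zval-flat u i refl (trans (level-terminal u j) d≡0) z≤n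
        (s≤s (ℕₚ.≮⇒≥ λ j<i → j∉σ (subst (j ∈_) (sym σ≡) (from (∈-sig u i j) j<i))))

    far⇒z≡0 : ∀ {u i σ} → d (s i) u ≡ 1ℚ → i ∈ σ → z u σ ≡ 0ℚ
    far⇒z≡0 {u} {i} {σ} d≡1 i∈σ = z-elim (_≡ 0ℚ) u σ refl λ t σ≡ →
      zval-flat u t (trans (level-terminal u i) d≡1) (level-beyond u ℕₚ.≤-refl)
        (to (∈-sig u t i) (subst (i ∈_) σ≡ i∈σ)) (Finₚ.toℕ<n t)

    sumGe-z : ∀ u A m → IsMaxDist A u m → sumGe (suc κ) A (z u) ≡ 1ℚ - m
    sumGe-z u A m ((i₀ , i₀∈A , m≡) , ≤m)
      with ∃-greatest (λ a → π u ⟨$⟩ʳ a ∈? A) (π u ⟨$⟩ˡ i₀ , subst (_∈ A) (sym (inverseʳ (π u))) i₀∈A)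
    ... | p , πp∈A , last = begin
      sumGe (suc κ) A (z u)                     ≡⟨ sumℚ-filter (A ⊆?_) (z u) (allL (suc κ)) ⟩
      sumL (suc κ) (λ σ → [ A ⊆? σ ]· z u σ)    ≡⟨ sumL-[]·z u (A ⊆?_) (s≤s (ℕₚ.<⇒≤ (Finₚ.toℕ<n p))) A⊆sig⇔ ⟩
      1ℚ - level u (suc (toℕ p))                 ≡⟨ cong (λ r → 1ℚ - r) level≡m ⟩
      1ℚ - m ∎
      where
      open ≡-Reasoning
      at-position : ∀ {j} → j ∈ A → π u ⟨$⟩ʳ (π u ⟨$⟩ˡ j) ∈ A
      at-position = subst (_∈ A) (sym (inverseʳ (π u)))
      A⊆sig⇔ : ∀ i → A ⊆ sig u i ⇔ suc (toℕ p) ℕ.≤ toℕ i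
      A⊆sig⇔ i = mk⇔ (λ A⊆ → to (∈-sig-position u i p) (A⊆ πp∈A))
        (λ p<i {a} a∈A → from (∈-sig u i a) (ℕₚ.≤-<-trans (last _ (at-position a∈A)) p<i))
      level≡m : level u (suc (toℕ p)) ≡ m
      level≡m = ≤-antisym (subst (_≤ m) (sym (level-position u p)) (≤m _ πp∈A))
        (subst (_≤ level u (suc (toℕ p))) (trans (level-terminal u i₀) (sym m≡))
               (level-mono u (s≤s (last _ (at-position i₀∈A)))))

lemma2 : (G : Digraph) (w x : Fin (nE G) → ℚ) {κ : ℕ}
         (s : Fin (suc κ) → Fin (nV G)) (EH : Fin (suc κ) → Fin (suc κ) → Set)
         (d : Fin (nV G) → Fin (nV G) → ℚ) (π : Fin (nV G) → Permutation′ (suc κ)) →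
         (∀ e → 0ℚ ≤ w e) →
         Injective _≡_ _≡_ s →
         Feasible G x s EH →
         IsShortestDist G x d →
         (∀ u v → d u v ≤ 1ℚ) →
         Sorted s d π →
         let open Construction s d π in
         (∀ u σ → 0ℚ ≤ z u σ)
         × (∀ u → sumL (suc κ) (z u) ≡ 1ℚ)
         × (∀ u (A : Subset (suc κ)) → Nonempty A → ∀ m → IsMaxDist A u m →
              sumGe (suc κ) A (z u) ≡ 1ℚ - m)
         × (∀ j (σ : Subset (suc κ)) → j ∉ σ → z (s j) σ ≡ 0ℚ)
         × (∀ i j → EH i j → ∀ (σ : Subset (suc κ)) → i ∈ σ → z (s j) σ ≡ 0ℚ)
lemma2 G w x s EH d π _ _ feasible@(x≥0 , _) shortest d≤1 sorted =
  z-nonneg ,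
  sumL-z ,
  (λ u A _ m → sumGe-z u A m) ,
  (λ j σ → near⇒z≡0 (dist-self G x≥0 shortest (s j))) ,
  (λ i j ij∈EH σ → far⇒z≡0 (≤-antisym (d≤1 _ _) (demand-dist-≥1 feasible shortest ij∈EH)))
  where
  open Levels s d π
  open Monotone sorted (dist-nonneg G x≥0 shortest) d≤1
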